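{- A cirquent is an instance of some binary tautology if and only if it is an atomic-level instance of some normal binary tautology.
   Context: Formulas: built from infinitely many propositional atoms using $\neg,\wedge,\vee$ (binary), with $\neg$ only on atoms; $\neg\neg F$, $\neg(F\wedge G)$, $\neg(F\vee G)$ abbreviate $F$, $\neg F\vee\neg G$, $\neg F\wedge\neg G$. A $k$-ary cirquent is a pair consisting of a structure (a finite sequence, repetitions allowed, of subsets of $\{1,\dots,k\}$, called groups) and a pool $\langle F_1,\dots,F_k\rangle$ of formulas (oformulas); group $\Gamma$ contains $F_i$ for $i\in\Gamma$. A classical model assigns truth values to atoms, extended classically; a group is true in a model iff some oformula of it is; a cirquent is true iff all its groups are; it is a tautology iff true in every model. An occurrence of an atom in a cirquent is an occurrence in one of its oformulas; it is negative if it is preceded by $\neg$, positive otherwise. A cirquent is binary iff no atom has more than two occurrences in it; it is normal binary iff it is binary and whenever an atom has two occurrences, one is positive and the other negative. A (normal) binary tautology is a (normal) binary cirquent that is a tautology. A substitution $\sigma$ maps atoms to formulas, extended by $\sigma(\neg P)=\neg\sigma(P)$, $\sigma(F\wedge G)=\sigma(F)\wedge\sigma(G)$, $\sigma(F\vee G)=\sigma(F)\vee\sigma(G)$, and to cirquents by applying it to every oformula, keeping the structure; it is atomic-level if it maps every atom to an atom. $B$ is an (atomic-level) instance of $A$ iff $B=\sigma(A)$ for some (atomic-level) substitution $\sigma$. -}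

module Defs where

open import Data.Nat using (ℕ; _+_; _≤_; _≟_)
open import Data.Bool using (Bool; true; false; not; _∧_; _∨_; if_then_else_)
open import Data.Fin using (Fin)
open import Data.Fin.Subset using (Subset; _∈_)
open import Data.Vec using (Vec; lookup; map; foldr)
open import Data.List using (List)
open import Data.List.Relation.Unary.All using (All)
open import Data.Product using (Σ; ∃; _×_)
open import Relation.Binary.PropositionalEquality using (_≡_)
open import Relation.Nullary.Decidable using (⌊_⌋)

Atom : Set
Atom = ℕ

-- Formulas in negation normal form: ¬ only on atoms.
data Formula : Set where
  atom    : Atom → Formula
  negAtom : Atom → Formula
  _∧ᶠ_    : Formula → Formula → Formula
  _∨ᶠ_    : Formula → Formula → Formula

¬ᶠ : Formula → Formula
¬ᶠ (atom P)    = negAtom P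
¬ᶠ (negAtom P) = atom P
¬ᶠ (F ∧ᶠ G)    = ¬ᶠ F ∨ᶠ ¬ᶠ G
¬ᶠ (F ∨ᶠ G)    = ¬ᶠ F ∧ᶠ ¬ᶠ G

record Cirquent (k : ℕ) : Set where
  constructor cirq
  field
    structure : List (Subset k)
    pool      : Vec Formula k
open Cirquent public

Model : Set
Model = Atom → Bool

evalF : Model → Formula → Bool
evalF M (atom P)    = M P
evalF M (negAtom P) = not (M P)
evalF M (F ∧ᶠ G)    = evalF M F ∧ evalF M G
evalF M (F ∨ᶠ G)    = evalF M F ∨ evalF M G

GroupTrue : ∀ {k} → Model → Vec Formula k → Subset k → Set
GroupTrue M pl Γ = ∃ λ i → (i ∈ Γ) × (evalF M (lookup pl i) ≡ true)

CirquentTrue : ∀ {k} → Model → Cirquent k → Set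
CirquentTrue M C = All (GroupTrue M (pool C)) (structure C)

Tautology : ∀ {k} → Cirquent k → Set
Tautology C = ∀ (M : Model) → CirquentTrue M C

posOccF : Atom → Formula → ℕ
posOccF P (atom Q)    = if ⌊ P ≟ Q ⌋ then 1 else 0
posOccF P (negAtom Q) = 0
posOccF P (F ∧ᶠ G)    = posOccF P F + posOccF P G
posOccF P (F ∨ᶠ G)    = posOccF P F + posOccF P G

negOccF : Atom → Formula → ℕ
negOccF P (atom Q)    = 0
negOccF P (negAtom Q) = if ⌊ P ≟ Q ⌋ then 1 else 0
negOccF P (F ∧ᶠ G)    = negOccF P F + negOccF P G
negOccF P (F ∨ᶠ G)    = negOccF P F + negOccF P G

posOcc : ∀ {k} → Atom → Cirquent k → ℕ
posOcc P C = foldr _ _+_ 0 (map (posOccF P) (pool C))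

negOcc : ∀ {k} → Atom → Cirquent k → ℕ
negOcc P C = foldr _ _+_ 0 (map (negOccF P) (pool C))

occ : ∀ {k} → Atom → Cirquent k → ℕ
occ P C = posOcc P C + negOcc P C

Binary : ∀ {k} → Cirquent k → Set
Binary C = ∀ (P : Atom) → occ P C ≤ 2

NormalBinary : ∀ {k} → Cirquent k → Set
NormalBinary C = Binary C ×
  (∀ (P : Atom) → occ P C ≡ 2 → (posOcc P C ≡ 1 × negOcc P C ≡ 1))

BinaryTautology : ∀ {k} → Cirquent k → Set
BinaryTautology C = Binary C × Tautology C

NormalBinaryTautology : ∀ {k} → Cirquent k → Set
NormalBinaryTautology C = NormalBinary C × Tautology C

Substitution : Set
Substitution = Atom → Formula

substF : Substitution → Formula → Formula
substF σ (atom P)    = σ P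
substF σ (negAtom P) = ¬ᶠ (σ P)
substF σ (F ∧ᶠ G)    = substF σ F ∧ᶠ substF σ G
substF σ (F ∨ᶠ G)    = substF σ F ∨ᶠ substF σ G

substC : ∀ {k} → Substitution → Cirquent k → Cirquent k
substC σ C = cirq (structure C) (map (substF σ) (pool C))

AtomicLevel : Substitution → Set
AtomicLevel σ = ∀ (P : Atom) → ∃ λ Q → σ P ≡ atom Q

InstanceOf : ∀ {k} → Cirquent k → Cirquent k → Set
InstanceOf B A = ∃ λ σ → B ≡ substC σ A

AtomicInstanceOf : ∀ {k} → Cirquent k → Cirquent k → Set
AtomicInstanceOf B A = ∃ λ σ → AtomicLevel σ × (B ≡ substC σ A)

-- Only the left-to-right direction has content; let B = σ A with A a binary tautology.
-- First rename the occurrences of atoms in A apart, tagging each new name with its position,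
-- except that an atom occurring both positively and negatively (hence exactly once each way)
-- gets one shared name. The result A′ is normal binary, and still a tautology: a model of A′
-- induces one of A that reads each shared atom off its new name and makes any other atom false
-- if it occurs only positively and true otherwise, so every literal of A is at most as true as
-- its counterpart in A′. Forgetting the tags turns A′ back into A.
-- Then, for A normal binary, replace each atom P by a copy of σ P whose occurrences are renamed
-- apart with tags (P, position). This is an instance of A, hence a tautology; an atom tagged by
-- P occurs once in that copy, and P at most once with each polarity in A, so the result is
-- normal binary. Forgetting the tags gives σ A.

module Submission where

open import Defs
open import Data.Nat using (ℕ; zero; suc; pred; _+_; _*_; _≤_; _<_; z≤n; s≤s; z<s; _≟_; _≤?_; _<?_)
open import Data.Nat.Properties
open import Data.Nat.Tactic.RingSolver using (solve-∀)
open import Algebra.Properties.CommutativeSemigroup +-commutativeSemigroup using (interchange)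
open import Data.Bool using (true; false; not; T; _∧_; _∨_; if_then_else_)
open import Data.Bool.Properties using (∨-∧-booleanAlgebra; not-involutive; T-≡; T-∧; T-∨)
open import Algebra.Lattice.Properties.BooleanAlgebra ∨-∧-booleanAlgebra using (deMorgan₁; deMorgan₂)
open import Data.Fin as Fin using (Fin)
open import Data.Vec using (Vec; []; _∷_; lookup; map; foldr)
open import Data.Vec.Properties using (map-∘; map-cong; lookup-map)
import Data.List.Relation.Unary.All as All
open import Data.Empty using (⊥-elim)
open import Data.Product using (∃; _×_; _,_; proj₁; proj₂)
import Data.Sum as Sum
open import Function.Base using (_∘_; id)
open import Function.Bundles using (_⇔_; mk⇔; Equivalence)
open import Relation.Nullary using (Dec; yes; no)
open import Relation.Nullary.Decidable using (⌊_⌋; _×-dec_; isYes; toWitness; fromWitness)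
open import Relation.Binary.PropositionalEquality
open ≡-Reasoning

open Equivalence using (to; from)

-- Cantor pairing

tri : ℕ → ℕ
tri zero    = 0
tri (suc s) = tri s + suc s

pair : ℕ → ℕ → ℕ
pair a b = tri (a + b) + b

next : ℕ × ℕ → ℕ × ℕ
next (zero  , b) = suc b , 0
next (suc a , b) = a , suc b

unpair : ℕ → ℕ × ℕ
unpair zero    = 0 , 0
unpair (suc n) = next (unpair n)

unpair-diagonal : ∀ s a b → a + b ≡ s → unpair (tri s + b) ≡ (a , b)
unpair-diagonal zero    zero    zero    refl = refl
unpair-diagonal zero    zero    (suc b) ()
unpair-diagonal zero    (suc a) b       ()
unpair-diagonal (suc s) a       zero    a+0≡1+s = begin
  unpair (tri s + suc s + 0) ≡⟨ cong unpair (trans (+-identityʳ _) (+-suc (tri s) s)) ⟩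
  next (unpair (tri s + s))  ≡⟨ cong next (unpair-diagonal s 0 s refl) ⟩
  (suc s , 0)                ≡⟨ cong (_, 0) (trans (sym a+0≡1+s) (+-identityʳ a)) ⟩
  (a , 0)                    ∎
unpair-diagonal (suc s) a       (suc b) a+1+b≡1+s = begin
  unpair (tri (suc s) + suc b)    ≡⟨ cong unpair (+-suc (tri (suc s)) b) ⟩
  next (unpair (tri (suc s) + b)) ≡⟨ cong next (unpair-diagonal (suc s) (suc a) b (trans (sym (+-suc a b)) a+1+b≡1+s)) ⟩
  (a , suc b)                     ∎

unpair-pair : ∀ a b → unpair (pair a b) ≡ (a , b)
unpair-pair a b = unpair-diagonal (a + b) a b refl

pair≡⇒unpair≡ : ∀ {a b n} → pair a b ≡ n → unpair n ≡ (a , b)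
pair≡⇒unpair≡ {a} {b} refl = unpair-pair a b

untag : Atom → Atom
untag n = proj₂ (unpair n)

untag-pair : ∀ t P → untag (pair t P) ≡ P
untag-pair t P = cong proj₂ (unpair-pair t P)

untagₛ : Substitution
untagₛ = atom ∘ untag

untagₛ-atomic : AtomicLevel untagₛ
untagₛ-atomic P = untag P , refl

¬ᶠ-involutive : ∀ F → ¬ᶠ (¬ᶠ F) ≡ F
¬ᶠ-involutive (atom P)    = refl
¬ᶠ-involutive (negAtom P) = refl
¬ᶠ-involutive (F ∧ᶠ G)    = cong₂ _∧ᶠ_ (¬ᶠ-involutive F) (¬ᶠ-involutive G)
¬ᶠ-involutive (F ∨ᶠ G)    = cong₂ _∨ᶠ_ (¬ᶠ-involutive F) (¬ᶠ-involutive G)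

evalF-¬ᶠ : ∀ M F → evalF M (¬ᶠ F) ≡ not (evalF M F)
evalF-¬ᶠ M (atom P)    = refl
evalF-¬ᶠ M (negAtom P) = sym (not-involutive (M P))
evalF-¬ᶠ M (F ∧ᶠ G)    = trans (cong₂ _∨_ (evalF-¬ᶠ M F) (evalF-¬ᶠ M G)) (sym (deMorgan₁ (evalF M F) (evalF M G)))
evalF-¬ᶠ M (F ∨ᶠ G)    = trans (cong₂ _∧_ (evalF-¬ᶠ M F) (evalF-¬ᶠ M G)) (sym (deMorgan₂ (evalF M F) (evalF M G)))

substF-¬ᶠ : ∀ σ F → substF σ (¬ᶠ F) ≡ ¬ᶠ (substF σ F)
substF-¬ᶠ σ (atom P)    = refl
substF-¬ᶠ σ (negAtom P) = sym (¬ᶠ-involutive (σ P))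
substF-¬ᶠ σ (F ∧ᶠ G)    = cong₂ _∨ᶠ_ (substF-¬ᶠ σ F) (substF-¬ᶠ σ G)
substF-¬ᶠ σ (F ∨ᶠ G)    = cong₂ _∧ᶠ_ (substF-¬ᶠ σ F) (substF-¬ᶠ σ G)

evalF-substF : ∀ M σ F → evalF M (substF σ F) ≡ evalF (evalF M ∘ σ) F
evalF-substF M σ (atom P)    = refl
evalF-substF M σ (negAtom P) = evalF-¬ᶠ M (σ P)
evalF-substF M σ (F ∧ᶠ G)    = cong₂ _∧_ (evalF-substF M σ F) (evalF-substF M σ G)
evalF-substF M σ (F ∨ᶠ G)    = cong₂ _∨_ (evalF-substF M σ F) (evalF-substF M σ G)

substF-substF : ∀ τ σ F → substF τ (substF σ F) ≡ substF (substF τ ∘ σ) F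
substF-substF τ σ (atom P)    = refl
substF-substF τ σ (negAtom P) = substF-¬ᶠ τ (σ P)
substF-substF τ σ (F ∧ᶠ G)    = cong₂ _∧ᶠ_ (substF-substF τ σ F) (substF-substF τ σ G)
substF-substF τ σ (F ∨ᶠ G)    = cong₂ _∨ᶠ_ (substF-substF τ σ F) (substF-substF τ σ G)

substF-cong : ∀ {σ σ′} → (∀ P → σ P ≡ σ′ P) → ∀ F → substF σ F ≡ substF σ′ F
substF-cong σ≗σ′ (atom P)    = σ≗σ′ P
substF-cong σ≗σ′ (negAtom P) = cong ¬ᶠ (σ≗σ′ P)
substF-cong σ≗σ′ (F ∧ᶠ G)    = cong₂ _∧ᶠ_ (substF-cong σ≗σ′ F) (substF-cong σ≗σ′ G)
substF-cong σ≗σ′ (F ∨ᶠ G)    = cong₂ _∨ᶠ_ (substF-cong σ≗σ′ F) (substF-cong σ≗σ′ G)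

substC-substC : ∀ {k} τ σ (A : Cirquent k) → substC τ (substC σ A) ≡ substC (substF τ ∘ σ) A
substC-substC τ σ A = cong (cirq (structure A)) (begin
  map (substF τ) (map (substF σ) (pool A)) ≡⟨ map-∘ (substF τ) (substF σ) (pool A) ⟨
  map (substF τ ∘ substF σ) (pool A)       ≡⟨ map-cong (substF-substF τ σ) (pool A) ⟩
  map (substF (substF τ ∘ σ)) (pool A)     ∎)

substC-cong : ∀ {k σ σ′} → (∀ P → σ P ≡ σ′ P) → (A : Cirquent k) → substC σ A ≡ substC σ′ A
substC-cong σ≗σ′ A = cong (cirq (structure A)) (map-cong (substF-cong σ≗σ′) (pool A))

substC-tautology : ∀ {k} σ {A : Cirquent k} → Tautology A → Tautology (substC σ A)
substC-tautology σ {A} taut M = All.map transfer (taut (evalF M ∘ σ))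
  where
  transfer : ∀ {Γ} → GroupTrue (evalF M ∘ σ) (pool A) Γ → GroupTrue M (map (substF σ) (pool A)) Γ
  transfer (i , i∈Γ , holds) = i , i∈Γ , (begin
    evalF M (lookup (map (substF σ) (pool A)) i) ≡⟨ cong (evalF M) (lookup-map i (substF σ) (pool A)) ⟩
    evalF M (substF σ (lookup (pool A) i))       ≡⟨ evalF-substF M σ (lookup (pool A) i) ⟩
    evalF (evalF M ∘ σ) (lookup (pool A) i)      ≡⟨ holds ⟩
    true                                         ∎)

δ : Atom → Atom → ℕ
δ R Q = if ⌊ R ≟ Q ⌋ then 1 else 0

δ-refl : ∀ P → δ P P ≡ 1
δ-refl P with P ≟ P
... | yes _   = refl
... | no P≢P = ⊥-elim (P≢P refl)

δ-≢ : ∀ {R Q} → R ≢ Q → δ R Q ≡ 0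
δ-≢ {R} {Q} R≢Q with R ≟ Q
... | yes R≡Q = ⊥-elim (R≢Q R≡Q)
... | no  _   = refl

δ-≤1 : ∀ R Q → δ R Q ≤ 1
δ-≤1 R Q with R ≟ Q
... | yes _ = ≤-refl
... | no  _ = z≤n

δ-≤ : ∀ {R R′ P P′} → (R ≡ R′ → P ≡ P′) → δ R R′ ≤ δ P P′
δ-≤ {R} {R′} {P} {P′} R≡R′⇒P≡P′ with R ≟ R′
... | no  _    = z≤n
... | yes R≡R′ rewrite R≡R′⇒P≡P′ R≡R′ | δ-refl P′ = ≤-refl

occF : Atom → Formula → ℕ
occF R F = posOccF R F + negOccF R F

occF-∧ᶠ : ∀ R F G → occF R (F ∧ᶠ G) ≡ occF R F + occF R G
occF-∧ᶠ R F G = interchange (posOccF R F) (posOccF R G) (negOccF R F) (negOccF R G)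

occF-∨ᶠ : ∀ R F G → occF R (F ∨ᶠ G) ≡ occF R F + occF R G
occF-∨ᶠ R F G = interchange (posOccF R F) (posOccF R G) (negOccF R F) (negOccF R G)

posOccF-¬ᶠ : ∀ R F → posOccF R (¬ᶠ F) ≡ negOccF R F
negOccF-¬ᶠ : ∀ R F → negOccF R (¬ᶠ F) ≡ posOccF R F
posOccF-¬ᶠ R (atom P)    = refl
posOccF-¬ᶠ R (negAtom P) = refl
posOccF-¬ᶠ R (F ∧ᶠ G)    = cong₂ _+_ (posOccF-¬ᶠ R F) (posOccF-¬ᶠ R G)
posOccF-¬ᶠ R (F ∨ᶠ G)    = cong₂ _+_ (posOccF-¬ᶠ R F) (posOccF-¬ᶠ R G)
negOccF-¬ᶠ R (atom P)    = refl
negOccF-¬ᶠ R (negAtom P) = refl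
negOccF-¬ᶠ R (F ∧ᶠ G)    = cong₂ _+_ (negOccF-¬ᶠ R F) (negOccF-¬ᶠ R G)
negOccF-¬ᶠ R (F ∨ᶠ G)    = cong₂ _+_ (negOccF-¬ᶠ R F) (negOccF-¬ᶠ R G)

posOccᵥ negOccᵥ occᵥ : ∀ {n} → Atom → Vec Formula n → ℕ
posOccᵥ P v = foldr _ _+_ 0 (map (posOccF P) v)
negOccᵥ P v = foldr _ _+_ 0 (map (negOccF P) v)
occᵥ R v = posOccᵥ R v + negOccᵥ R v

occᵥ-∷ : ∀ {n} R F (v : Vec Formula n) → occᵥ R (F ∷ v) ≡ occF R F + occᵥ R v
occᵥ-∷ R F v = interchange (posOccF R F) (posOccᵥ R v) (negOccF R F) (negOccᵥ R v)

normalBinary⇔≤1 : ∀ {k} {C : Cirquent k} → NormalBinary C ⇔ (∀ P → posOcc P C ≤ 1 × negOcc P C ≤ 1)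
normalBinary⇔≤1 {C = C} = mk⇔
  (λ (bin , two⇒1,1) P → split (posOcc P C) (negOcc P C) (bin P) (two⇒1,1 P))
  (λ ≤1 → (λ P → +-mono-≤ (proj₁ (≤1 P)) (proj₂ (≤1 P))) , (λ P → two (proj₁ (≤1 P)) (proj₂ (≤1 P))))
  where
  split : ∀ p n → p + n ≤ 2 → (p + n ≡ 2 → p ≡ 1 × n ≡ 1) → p ≤ 1 × n ≤ 1
  split 0 0 _ _                             = z≤n , z≤n
  split 0 1 _ _                             = z≤n , ≤-refl
  split 1 0 _ _                             = ≤-refl , z≤n
  split 1 1 _ _                             = ≤-refl , ≤-refl
  split 0 2 _ two⇒1,1 with () ← proj₁ (two⇒1,1 refl)
  split 2 0 _ two⇒1,1 with () ← proj₂ (two⇒1,1 refl)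
  split 0 (suc (suc (suc _))) (s≤s (s≤s ())) _
  split 1 (suc (suc _))       (s≤s (s≤s ())) _
  split 2 (suc _)             (s≤s (s≤s ())) _
  split (suc (suc (suc _))) _ (s≤s (s≤s ())) _
  two : ∀ {p n} → p ≤ 1 → n ≤ 1 → p + n ≡ 2 → p ≡ 1 × n ≡ 1
  two (s≤s z≤n) (s≤s z≤n) refl = refl , refl
  two z≤n       z≤n       ()
  two z≤n       (s≤s z≤n) ()
  two (s≤s z≤n) z≤n       ()

mixed-≤1 : ∀ {p n} → p + n ≤ 2 → 1 ≤ p → 1 ≤ n → p ≤ 1 × n ≤ 1
mixed-≤1 {p} {n} p+n≤2 1≤p 1≤n =
  +-cancelʳ-≤ 1 p 1 (≤-trans (+-monoʳ-≤ p 1≤n) p+n≤2) ,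
  +-cancelˡ-≤ 1 n 1 (≤-trans (+-monoˡ-≤ n 1≤p) p+n≤2)

-- Renaming atom occurrences by position

size : Formula → ℕ
size (atom _)    = 1
size (negAtom _) = 1
size (F ∧ᶠ G)    = size F + size G
size (F ∨ᶠ G)    = size F + size G

sizeᵥ : ∀ {n} → Vec Formula n → ℕ
sizeᵥ []      = 0
sizeᵥ (F ∷ v) = size F + sizeᵥ v

-- Literal occurrences are numbered left to right starting from c.
relabel : (ℕ → Atom → Atom) → ℕ → Formula → Formula
relabel f c (atom P)    = atom (f c P)
relabel f c (negAtom P) = negAtom (f c P)
relabel f c (F ∧ᶠ G)    = relabel f c F ∧ᶠ relabel f (c + size F) G
relabel f c (F ∨ᶠ G)    = relabel f c F ∨ᶠ relabel f (c + size F) G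

relabelᵥ : ∀ {n} → (ℕ → Atom → Atom) → ℕ → Vec Formula n → Vec Formula n
relabelᵥ f c []      = []
relabelᵥ f c (F ∷ v) = relabel f c F ∷ relabelᵥ f (c + size F) v

module _ {f : ℕ → Atom → Atom} {g : Atom → Atom} (g∘f≗proj₂ : ∀ i P → g (f i P) ≡ P) where

  substF-relabel : ∀ c F → substF (atom ∘ g) (relabel f c F) ≡ F
  substF-relabel c (atom P)    = cong atom (g∘f≗proj₂ c P)
  substF-relabel c (negAtom P) = cong negAtom (g∘f≗proj₂ c P)
  substF-relabel c (F ∧ᶠ G)    = cong₂ _∧ᶠ_ (substF-relabel c F) (substF-relabel (c + size F) G)
  substF-relabel c (F ∨ᶠ G)    = cong₂ _∨ᶠ_ (substF-relabel c F) (substF-relabel (c + size F) G)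

  map-substF-relabelᵥ : ∀ {n} c (v : Vec Formula n) → map (substF (atom ∘ g)) (relabelᵥ f c v) ≡ v
  map-substF-relabelᵥ c []      = refl
  map-substF-relabelᵥ c (F ∷ v) = cong₂ _∷_ (substF-relabel c F) (map-substF-relabelᵥ (c + size F) v)

module _ (f : ℕ → Atom → Atom) (R : Atom) where

  Avoids : ℕ → ℕ → Set
  Avoids c d = ∀ i P → c ≤ i → i < d → f i P ≢ R

  avoids-left : ∀ c m n → Avoids c (c + (m + n)) → Avoids c (c + m)
  avoids-left c m n avoids i P c≤i i<c+m =
    avoids i P c≤i (<-≤-trans i<c+m (+-monoʳ-≤ c (m≤m+n m n)))

  avoids-right : ∀ c m n → Avoids c (c + (m + n)) → Avoids (c + m) (c + m + n)
  avoids-right c m n avoids i P c+m≤i i<c+m+n =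
    avoids i P (≤-trans (m≤m+n c m) c+m≤i) (subst (i <_) (+-assoc c m n) i<c+m+n)

  occF-relabel-avoids : ∀ c F → Avoids c (c + size F) → occF R (relabel f c F) ≡ 0
  occF-relabel-avoids c (atom P)    avoids = cong (_+ 0) (δ-≢ {R} {f c P} (avoids c P ≤-refl (m<m+n c z<s) ∘ sym))
  occF-relabel-avoids c (negAtom P) avoids = δ-≢ {R} {f c P} (avoids c P ≤-refl (m<m+n c z<s) ∘ sym)
  occF-relabel-avoids c (F ∧ᶠ G)    avoids = trans (occF-∧ᶠ R (relabel f c F) (relabel f (c + size F) G)) (cong₂ _+_
    (occF-relabel-avoids c F (avoids-left c (size F) (size G) avoids))
    (occF-relabel-avoids (c + size F) G (avoids-right c (size F) (size G) avoids)))
  occF-relabel-avoids c (F ∨ᶠ G)    avoids = trans (occF-∨ᶠ R (relabel f c F) (relabel f (c + size F) G)) (cong₂ _+_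
    (occF-relabel-avoids c F (avoids-left c (size F) (size G) avoids))
    (occF-relabel-avoids (c + size F) G (avoids-right c (size F) (size G) avoids)))

  occᵥ-relabelᵥ-avoids : ∀ {n} c (v : Vec Formula n) → Avoids c (c + sizeᵥ v) → occᵥ R (relabelᵥ f c v) ≡ 0
  occᵥ-relabelᵥ-avoids c []      avoids = refl
  occᵥ-relabelᵥ-avoids c (F ∷ v) avoids = trans (occᵥ-∷ R (relabel f c F) (relabelᵥ f (c + size F) v)) (cong₂ _+_
    (occF-relabel-avoids c F (avoids-left c (size F) (sizeᵥ v) avoids))
    (occᵥ-relabelᵥ-avoids (c + size F) v (avoids-right c (size F) (sizeᵥ v) avoids)))

  module _ (x : ℕ) (only-x : ∀ i P → f i P ≡ R → i ≡ x) where

    private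
      juxtapose-≤1 : ∀ c m n {a b} → (Avoids c (c + m) → a ≡ 0) → (Avoids (c + m) (c + m + n) → b ≡ 0) →
                     a ≤ 1 → b ≤ 1 → a + b ≤ 1
      juxtapose-≤1 c m n {a} left right a≤1 b≤1 with x <? c + m
      ... | yes x<c+m rewrite right (λ i P c+m≤i _ fiP≡R → <-irrefl (sym (only-x i P fiP≡R)) (<-≤-trans x<c+m c+m≤i))
                     = subst (_≤ 1) (sym (+-identityʳ a)) a≤1
      ... | no  x≮c+m rewrite left (λ i P _ i<c+m fiP≡R → <-irrefl (only-x i P fiP≡R) (<-≤-trans i<c+m (≮⇒≥ x≮c+m)))
                     = b≤1

    occF-relabel-≤1 : ∀ c F → occF R (relabel f c F) ≤ 1
    occF-relabel-≤1 c (atom P)    = subst (_≤ 1) (sym (+-identityʳ _)) (δ-≤1 R (f c P))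
    occF-relabel-≤1 c (negAtom P) = δ-≤1 R (f c P)
    occF-relabel-≤1 c (F ∧ᶠ G)    = subst (_≤ 1) (sym (occF-∧ᶠ R (relabel f c F) (relabel f (c + size F) G)))
      (juxtapose-≤1 c (size F) (size G) (occF-relabel-avoids c F) (occF-relabel-avoids (c + size F) G)
                    (occF-relabel-≤1 c F) (occF-relabel-≤1 (c + size F) G))
    occF-relabel-≤1 c (F ∨ᶠ G)    = subst (_≤ 1) (sym (occF-∨ᶠ R (relabel f c F) (relabel f (c + size F) G)))
      (juxtapose-≤1 c (size F) (size G) (occF-relabel-avoids c F) (occF-relabel-avoids (c + size F) G)
                    (occF-relabel-≤1 c F) (occF-relabel-≤1 (c + size F) G))

    occᵥ-relabelᵥ-≤1 : ∀ {n} c (v : Vec Formula n) → occᵥ R (relabelᵥ f c v) ≤ 1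
    occᵥ-relabelᵥ-≤1 c []      = z≤n
    occᵥ-relabelᵥ-≤1 c (F ∷ v) = subst (_≤ 1) (sym (occᵥ-∷ R (relabel f c F) (relabelᵥ f (c + size F) v)))
      (juxtapose-≤1 c (size F) (sizeᵥ v) (occF-relabel-avoids c F) (occᵥ-relabelᵥ-avoids (c + size F) v)
                    (occF-relabel-≤1 c F) (occᵥ-relabelᵥ-≤1 (c + size F) v))

  module _ (P : Atom) (only-P : ∀ i Q → f i Q ≡ R → Q ≡ P) where

    private
      δ-relabel : ∀ c Q → δ R (f c Q) ≤ δ P Q
      δ-relabel c Q = δ-≤ (sym ∘ only-P c Q ∘ sym)

    posOccF-relabel-≤ : ∀ c F → posOccF R (relabel f c F) ≤ posOccF P F
    posOccF-relabel-≤ c (atom Q)    = δ-relabel c Q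
    posOccF-relabel-≤ c (negAtom Q) = z≤n
    posOccF-relabel-≤ c (F ∧ᶠ G)    = +-mono-≤ (posOccF-relabel-≤ c F) (posOccF-relabel-≤ (c + size F) G)
    posOccF-relabel-≤ c (F ∨ᶠ G)    = +-mono-≤ (posOccF-relabel-≤ c F) (posOccF-relabel-≤ (c + size F) G)

    negOccF-relabel-≤ : ∀ c F → negOccF R (relabel f c F) ≤ negOccF P F
    negOccF-relabel-≤ c (atom Q)    = z≤n
    negOccF-relabel-≤ c (negAtom Q) = δ-relabel c Q
    negOccF-relabel-≤ c (F ∧ᶠ G)    = +-mono-≤ (negOccF-relabel-≤ c F) (negOccF-relabel-≤ (c + size F) G)
    negOccF-relabel-≤ c (F ∨ᶠ G)    = +-mono-≤ (negOccF-relabel-≤ c F) (negOccF-relabel-≤ (c + size F) G)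

    posOccᵥ-relabelᵥ-≤ : ∀ {n} c (v : Vec Formula n) → posOccᵥ R (relabelᵥ f c v) ≤ posOccᵥ P v
    posOccᵥ-relabelᵥ-≤ c []      = z≤n
    posOccᵥ-relabelᵥ-≤ c (F ∷ v) = +-mono-≤ (posOccF-relabel-≤ c F) (posOccᵥ-relabelᵥ-≤ (c + size F) v)

    negOccᵥ-relabelᵥ-≤ : ∀ {n} c (v : Vec Formula n) → negOccᵥ R (relabelᵥ f c v) ≤ negOccᵥ P v
    negOccᵥ-relabelᵥ-≤ c []      = z≤n
    negOccᵥ-relabelᵥ-≤ c (F ∷ v) = +-mono-≤ (negOccF-relabel-≤ c F) (negOccᵥ-relabelᵥ-≤ (c + size F) v)

occurs-split : ∀ {X : Atom → Set} {a b : Atom → ℕ} →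
               (∀ P → 1 ≤ a P + b P → X P) → (∀ P → 1 ≤ a P → X P) × (∀ P → 1 ≤ b P → X P)
occurs-split h = (λ P → h P ∘ m≤n⇒m≤n+o _) , (λ P → h P ∘ m≤n⇒m≤o+n _)

T-not-anti : ∀ {a b} → (T b → T a) → T (not a) → T (not b)
T-not-anti {b = false} _    _  = _
T-not-anti {false} {true} b⇒a _ = b⇒a _
T-not-anti {true}  {true} _   ()

module _ (f : ℕ → Atom → Atom) (N M : Model) (Pos Neg : Atom → Set)
         (pos : ∀ i P → Pos P → T (N P) → T (M (f i P)))
         (neg : ∀ i P → Neg P → T (M (f i P)) → T (N P)) where

  evalF-relabel : ∀ c F → (∀ P → 1 ≤ posOccF P F → Pos P) → (∀ P → 1 ≤ negOccF P F → Neg P) →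
                  T (evalF N F) → T (evalF M (relabel f c F))
  evalF-relabel c (atom P)    pos⇒ _    = pos c P (pos⇒ P (≤-reflexive (sym (δ-refl P))))
  evalF-relabel c (negAtom P) _    neg⇒ = T-not-anti (neg c P (neg⇒ P (≤-reflexive (sym (δ-refl P)))))
  evalF-relabel c (F ∧ᶠ G)    pos⇒ neg⇒ holds =
    let posF , posG = occurs-split pos⇒; negF , negG = occurs-split neg⇒; holdsF , holdsG = to T-∧ holds
    in from T-∧ (evalF-relabel c F posF negF holdsF , evalF-relabel (c + size F) G posG negG holdsG)
  evalF-relabel c (F ∨ᶠ G)    pos⇒ neg⇒ holds =
    let posF , posG = occurs-split pos⇒; negF , negG = occurs-split neg⇒
    in from T-∨ (Sum.map (evalF-relabel c F posF negF) (evalF-relabel (c + size F) G posG negG) (to T-∨ holds))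

  evalF-lookup-relabelᵥ : ∀ {n} c (v : Vec Formula n) (i : Fin n) →
    (∀ P → 1 ≤ posOccᵥ P v → Pos P) → (∀ P → 1 ≤ negOccᵥ P v → Neg P) →
    T (evalF N (lookup v i)) → T (evalF M (lookup (relabelᵥ f c v) i))
  evalF-lookup-relabelᵥ c (F ∷ v) Fin.zero    pos⇒ neg⇒ =
    evalF-relabel c F (proj₁ (occurs-split pos⇒)) (proj₁ (occurs-split neg⇒))
  evalF-lookup-relabelᵥ c (F ∷ v) (Fin.suc i) pos⇒ neg⇒ =
    evalF-lookup-relabelᵥ (c + size F) v i (proj₂ (occurs-split pos⇒)) (proj₂ (occurs-split neg⇒))

+-*-interchange : ∀ p n p′ n′ a b → (p * a + n * b) + (p′ * a + n′ * b) ≡ (p + p′) * a + (n + n′) * b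
+-*-interchange = solve-∀

module _ (σ : Substitution) (R P : Atom) (only-σP : ∀ Q → Q ≢ P → occF R (σ Q) ≡ 0) where

  private
    a b : ℕ
    a = posOccF R (σ P)
    b = negOccF R (σ P)

    pos-private : ∀ Q → P ≢ Q → posOccF R (σ Q) ≡ 0
    pos-private Q P≢Q = m+n≡0⇒m≡0 _ (only-σP Q (P≢Q ∘ sym))
    neg-private : ∀ Q → P ≢ Q → negOccF R (σ Q) ≡ 0
    neg-private Q P≢Q = m+n≡0⇒n≡0 _ (only-σP Q (P≢Q ∘ sym))

  posOccF-substF : ∀ F → posOccF R (substF σ F) ≡ posOccF P F * posOccF R (σ P) + negOccF P F * negOccF R (σ P)
  posOccF-substF (atom Q) with P ≟ Q
  ... | yes refl = sym (trans (+-identityʳ _) (+-identityʳ _))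
  ... | no  P≢Q  = pos-private Q P≢Q
  posOccF-substF (negAtom Q) with P ≟ Q
  ... | yes refl = trans (posOccF-¬ᶠ R (σ P)) (sym (+-identityʳ _))
  ... | no  P≢Q  = trans (posOccF-¬ᶠ R (σ Q)) (neg-private Q P≢Q)
  posOccF-substF (F ∧ᶠ G) = trans (cong₂ _+_ (posOccF-substF F) (posOccF-substF G))
    (+-*-interchange (posOccF P F) (negOccF P F) (posOccF P G) (negOccF P G) a b)
  posOccF-substF (F ∨ᶠ G) = trans (cong₂ _+_ (posOccF-substF F) (posOccF-substF G))
    (+-*-interchange (posOccF P F) (negOccF P F) (posOccF P G) (negOccF P G) a b)

  negOccF-substF : ∀ F → negOccF R (substF σ F) ≡ posOccF P F * negOccF R (σ P) + negOccF P F * posOccF R (σ P)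
  negOccF-substF (atom Q) with P ≟ Q
  ... | yes refl = sym (trans (+-identityʳ _) (+-identityʳ _))
  ... | no  P≢Q  = neg-private Q P≢Q
  negOccF-substF (negAtom Q) with P ≟ Q
  ... | yes refl = trans (negOccF-¬ᶠ R (σ P)) (sym (+-identityʳ _))
  ... | no  P≢Q  = trans (negOccF-¬ᶠ R (σ Q)) (pos-private Q P≢Q)
  negOccF-substF (F ∧ᶠ G) = trans (cong₂ _+_ (negOccF-substF F) (negOccF-substF G))
    (+-*-interchange (posOccF P F) (negOccF P F) (posOccF P G) (negOccF P G) b a)
  negOccF-substF (F ∨ᶠ G) = trans (cong₂ _+_ (negOccF-substF F) (negOccF-substF G))
    (+-*-interchange (posOccF P F) (negOccF P F) (posOccF P G) (negOccF P G) b a)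

  posOccᵥ-map-substF : ∀ {n} (v : Vec Formula n) →
    posOccᵥ R (map (substF σ) v) ≡ posOccᵥ P v * posOccF R (σ P) + negOccᵥ P v * negOccF R (σ P)
  posOccᵥ-map-substF []      = refl
  posOccᵥ-map-substF (F ∷ v) =
    trans (cong₂ _+_ (posOccF-substF F) (posOccᵥ-map-substF v))
      (+-*-interchange (posOccF P F) (negOccF P F) (posOccᵥ P v) (negOccᵥ P v) a b)

  negOccᵥ-map-substF : ∀ {n} (v : Vec Formula n) →
    negOccᵥ R (map (substF σ) v) ≡ posOccᵥ P v * negOccF R (σ P) + negOccᵥ P v * posOccF R (σ P)
  negOccᵥ-map-substF []      = refl
  negOccᵥ-map-substF (F ∷ v) =
    trans (cong₂ _+_ (negOccF-substF F) (negOccᵥ-map-substF v))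
      (+-*-interchange (posOccF P F) (negOccF P F) (posOccᵥ P v) (negOccᵥ P v) b a)

AtomicInstanceOfNBT : ∀ {k} → Cirquent k → Set
AtomicInstanceOfNBT B = ∃ λ A → NormalBinaryTautology A × AtomicInstanceOf B A

module Normalise {k} (A : Cirquent k) where

  Mixed : Atom → Set
  Mixed P = 1 ≤ posOcc P A × 1 ≤ negOcc P A

  mixed? : ∀ P → Dec (Mixed P)
  mixed? P = (1 ≤? posOcc P A) ×-dec (1 ≤? negOcc P A)

  rename : ℕ → Atom → Atom
  rename i P with mixed? P
  ... | yes _ = pair 0 P
  ... | no  _ = pair (suc i) P

  untag-rename : ∀ i P → untag (rename i P) ≡ P
  untag-rename i P with mixed? P
  ... | yes _ = untag-pair 0 P
  ... | no  _ = untag-pair (suc i) P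

  A′ : Cirquent k
  A′ = cirq (structure A) (relabelᵥ rename 0 (pool A))

  A-instance : A ≡ substC untagₛ A′
  A-instance = cong (cirq (structure A)) (sym (map-substF-relabelᵥ untag-rename 0 (pool A)))

  A′-≤1 : Binary A → ∀ R → posOcc R A′ ≤ 1 × negOcc R A′ ≤ 1
  A′-≤1 bin R with mixed? (untag R)
  ... | yes (1≤p , 1≤n) =
    let p≤1 , n≤1 = mixed-≤1 (bin (untag R)) 1≤p 1≤n
    in ≤-trans (posOccᵥ-relabelᵥ-≤ rename R (untag R) only-untag 0 (pool A)) p≤1 ,
       ≤-trans (negOccᵥ-relabelᵥ-≤ rename R (untag R) only-untag 0 (pool A)) n≤1
    where
    only-untag : ∀ i Q → rename i Q ≡ R → Q ≡ untag R
    only-untag i Q refl = sym (untag-rename i Q)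
  ... | no ¬mixed =
    let occ≤1 = occᵥ-relabelᵥ-≤1 rename R (pred (proj₁ (unpair R))) only-one 0 (pool A)
    in m+n≤o⇒m≤o (posOcc R A′) occ≤1 , m+n≤o⇒n≤o (posOcc R A′) occ≤1
    where
    only-one : ∀ i Q → rename i Q ≡ R → i ≡ pred (proj₁ (unpair R))
    only-one i Q renamed with mixed? Q
    ... | yes mixed = ⊥-elim (¬mixed (subst Mixed (cong proj₂ (sym (pair≡⇒unpair≡ {0} {Q} renamed))) mixed))
    ... | no  _     = cong (pred ∘ proj₁) (sym (pair≡⇒unpair≡ {suc i} {Q} renamed))

  A′-tautology : Tautology A → Tautology A′
  A′-tautology taut M = All.map transfer (taut N)
    where
    N : Model
    N P with mixed? P
    ... | yes _ = M (pair 0 P)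
    ... | no  _ = isYes (1 ≤? negOcc P A)

    pos : ∀ i P → 1 ≤ posOcc P A → T (N P) → T (M (rename i P))
    pos i P 1≤p NP with mixed? P
    ... | yes _     = NP
    ... | no ¬mixed = ⊥-elim (¬mixed (1≤p , toWitness NP))

    neg : ∀ i P → 1 ≤ negOcc P A → T (M (rename i P)) → T (N P)
    neg i P 1≤n M-renamed with mixed? P
    ... | yes _ = M-renamed
    ... | no  _ = fromWitness 1≤n

    transfer : ∀ {Γ} → GroupTrue N (pool A) Γ → GroupTrue M (pool A′) Γ
    transfer (i , i∈Γ , holds) = i , i∈Γ , to T-≡
      (evalF-lookup-relabelᵥ rename N M _ _ pos neg 0 (pool A) i (λ _ → id) (λ _ → id) (from T-≡ holds))

binaryTautology⇒atomicInstanceOfNBT : ∀ {k} {A : Cirquent k} → BinaryTautology A → AtomicInstanceOfNBT A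
binaryTautology⇒atomicInstanceOfNBT {A = A} (bin , taut) =
  A′ , (from (normalBinary⇔≤1 {C = A′}) (A′-≤1 bin) , A′-tautology taut) , untagₛ , untagₛ-atomic , A-instance
  where open Normalise A

≤1-combination : ∀ {p n a b} → p ≤ 1 → n ≤ 1 → a + b ≤ 1 → p * a + n * b ≤ 1
≤1-combination {a = a} {b} p≤1 n≤1 a+b≤1 = ≤-trans (+-mono-≤ (*-monoˡ-≤ a p≤1) (*-monoˡ-≤ b n≤1))
  (subst (_≤ 1) (sym (cong₂ _+_ (*-identityˡ a) (*-identityˡ b))) a+b≤1)

module Linearise {k} (A : Cirquent k) (σ : Substitution) where

  σ′ : Substitution
  σ′ P = relabel (λ j Q → pair (pair P j) Q) 0 (σ P)

  A′ : Cirquent k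
  A′ = substC σ′ A

  σA-instance : substC σ A ≡ substC untagₛ A′
  σA-instance = begin
    substC σ A                   ≡⟨ substC-cong (λ P → sym (substF-relabel (λ j → untag-pair (pair P j)) 0 (σ P))) A ⟩
    substC (substF untagₛ ∘ σ′) A ≡⟨ substC-substC untagₛ σ′ A ⟨
    substC untagₛ A′             ∎

  tag≡ : ∀ {P j Q R} → pair (pair P j) Q ≡ R → unpair (proj₁ (unpair R)) ≡ (P , j)
  tag≡ {P} {j} {Q} tagged = pair≡⇒unpair≡ (sym (cong proj₁ (pair≡⇒unpair≡ {pair P j} {Q} tagged)))

  A′-≤1 : (∀ P → posOcc P A ≤ 1 × negOcc P A ≤ 1) → ∀ R → posOcc R A′ ≤ 1 × negOcc R A′ ≤ 1
  A′-≤1 A-≤1 R =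
    subst (_≤ 1) (sym (posOccᵥ-map-substF σ′ R P only-σ′P (pool A))) (≤1-combination p≤1 n≤1 occ≤1) ,
    subst (_≤ 1) (sym (negOccᵥ-map-substF σ′ R P only-σ′P (pool A)))
      (≤1-combination p≤1 n≤1 (subst (_≤ 1) (+-comm (posOccF R (σ′ P)) _) occ≤1))
    where
    P j : ℕ
    P = proj₁ (unpair (proj₁ (unpair R)))
    j = proj₂ (unpair (proj₁ (unpair R)))

    only-σ′P : ∀ Q → Q ≢ P → occF R (σ′ Q) ≡ 0
    only-σ′P Q Q≢P = occF-relabel-avoids _ R 0 (σ Q) (λ i Q′ _ _ tagged → Q≢P (cong proj₁ (sym (tag≡ {Q} {i} {Q′} tagged))))

    occ≤1 : occF R (σ′ P) ≤ 1
    occ≤1 = occF-relabel-≤1 _ R j (λ i Q tagged → cong proj₂ (sym (tag≡ {P} {i} {Q} tagged))) 0 (σ P)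

    p≤1 : posOcc P A ≤ 1
    p≤1 = proj₁ (A-≤1 P)
    n≤1 : negOcc P A ≤ 1
    n≤1 = proj₂ (A-≤1 P)

normalBinaryTautology⇒substC-atomicInstanceOfNBT : ∀ {k} {A : Cirquent k} → NormalBinaryTautology A →
                                                   ∀ σ → AtomicInstanceOfNBT (substC σ A)
normalBinaryTautology⇒substC-atomicInstanceOfNBT {A = A} (normal , taut) σ =
  A′ , (from (normalBinary⇔≤1 {C = A′}) (A′-≤1 (to (normalBinary⇔≤1 {C = A}) normal)) , substC-tautology σ′ {A} taut) ,
  untagₛ , untagₛ-atomic , σA-instance
  where open Linearise A σ

atomicInstanceOfNBT-substC : ∀ {k} {A : Cirquent k} → AtomicInstanceOfNBT A → ∀ σ → AtomicInstanceOfNBT (substC σ A)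
atomicInstanceOfNBT-substC (A₁ , nbt , ρ , _ , refl) σ =
  subst AtomicInstanceOfNBT (sym (substC-substC σ ρ A₁)) (normalBinaryTautology⇒substC-atomicInstanceOfNBT nbt (substF σ ∘ ρ))

lemma7p2 : ∀ {k : ℕ} (B : Cirquent k) →
    (∃ λ (A : Cirquent k) → BinaryTautology A × InstanceOf B A)
      ⇔ (∃ λ (A : Cirquent k) → NormalBinaryTautology A × AtomicInstanceOf B A)
lemma7p2 B = mk⇔
  (λ (A , binTaut , σ , B≡σA) →
     subst AtomicInstanceOfNBT (sym B≡σA) (atomicInstanceOfNBT-substC (binaryTautology⇒atomicInstanceOfNBT binTaut) σ))
  (λ (A , ((bin , _) , taut) , σ , _ , B≡σA) → A , (bin , taut) , σ , B≡σA)
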